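{- Let $k$ be a positive integer and let $c(n,k)$ be defined by $(1-k^2x)^{ -1/k}=\sum_{n\ge 0}c(n,k)x^n$. Let $p$ be a prime of the form $p=ku+1$ with $u$ an integer. Then for $n\ge 0$, $p$ does not divide $c(n,k)$ if and only if every digit of $n$ in base $p$ is less than $p/k$. -}

module Defs where

open import Data.Nat using (ℕ; zero; suc; _+_; _*_; _^_; _/_; _%_; _!; NonZero)
open import Data.Nat.Properties using (_!≢0)
open import Data.List using (map; upTo)
open import Data.Nat.ListAction using (product)

risingProd : ℕ → ℕ → ℕ
risingProd n k = product (map (λ j → 1 + j * k) (upTo n))

-- c(n,k) = [x^n] (1 - k² x)^{-1/k}
--        = (-k²)^n · binom(-1/k, n)
--        = k^n · ∏_{j<n} (1 + j k) / n!     (an exact division: c(n,k) ∈ ℕ)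
c : ℕ → ℕ → ℕ
c n k = _/_ (k ^ n * risingProd n k) (n !) {{n !≢0}}

digit : (p : ℕ) → .{{NonZero p}} → ℕ → ℕ → ℕ
digit p n i = _/_ n (p ^ i) {{Data.Nat.Properties.m^n≢0 p i}} % p

-- Write n = tP + r with r < P. As c(n,k) · n! = k^n ∏_{j<n} (1 + jk), it suffices to compare the
-- P-parts of n! and of ∏_{j<n} (1 + jk). In an arithmetic progression a + jb with P ∤ b, exactly one
-- index u in each block of P consecutive indices gives a multiple of P, and these multiples P(w + ib)
-- again form a progression. For n! (u = P - 1) this gives n! = P^t t! B, and for ∏ (1 + jk) (where
-- 1 + uk = P) it gives P^t ∏_{j<t} (1 + jk) U when r ≤ u and P^(t+1) ∏_{j≤t} (1 + jk) U when r > u,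
-- with B and U prime to P. So c(n,k) agrees with c(t,k) up to factors prime to P if kr < P, and is
-- divisible by P otherwise; induction on the base-P digits concludes.
-- The same decomposition shows that c(n,k) is an integer, one prime q at a time: v_q(n!) ≤ n settles
-- q ∣ k, and v_q(n!) ≤ v_q(∏_{j<n} (a + jb)) for q ∤ b settles q ∤ k.
module Submission where

open import Defs
open import Data.Nat
open import Data.Nat.Properties
open import Data.Nat.Divisibility
open import Data.Nat.DivMod
open import Data.Nat.Induction using (<-rec)
open import Data.Nat.Primality
open import Data.Nat.Primality.Factorisation using (PrimeFactorisation; factorise)
open import Data.Nat.Coprimality using (Coprime; coprime-Bézout)
open import Data.Nat.GCD using (module Bézout)
open import Data.Nat.ListAction using (product)
open import Data.Nat.ListAction.Properties using (product-++)
open import Data.Nat.Tactic.RingSolver using (solve-∀)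
open import Data.List using ([]; _∷_; _∷ʳ_; applyUpTo)
open import Data.List.Properties using (applyUpTo-∷ʳ; map-applyUpTo)
open import Data.List.Relation.Unary.All using (All; []; _∷_)
open import Data.Product using (∃-syntax; _×_; _,_)
open import Data.Product.Function.NonDependent.Propositional using (_×-⇔_)
open import Data.Sum using (inj₁; inj₂; [_,_]′)
open import Function using (id; _∘_)
open import Function.Bundles using (_⇔_; mk⇔; Equivalence)
import Function.Properties.Equivalence as ⇔
open import Relation.Binary.Definitions using (tri<; tri≈; tri>)
open import Relation.Binary.PropositionalEquality
open import Relation.Nullary using (¬_; contradiction; yes; no)

AP-shift : ∀ a b m n → a + (m + n) * b ≡ a + m * b + n * b
AP-shift = solve-∀

Π : ℕ → ℕ → ℕ → ℕ
Π a b zero    = 1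
Π a b (suc n) = Π a b n * (a + n * b)

Π-+ : ∀ a b m n → Π a b (m + n) ≡ Π a b m * Π (a + m * b) b n
Π-+ a b m zero    = trans (cong (Π a b) (+-identityʳ m)) (sym (*-identityʳ _))
Π-+ a b m (suc n) = begin
  Π a b (m + suc n)                                    ≡⟨ cong (Π a b) (+-suc m n) ⟩
  Π a b (m + n) * (a + (m + n) * b)                    ≡⟨ cong₂ _*_ (Π-+ a b m n) (AP-shift a b m n) ⟩
  Π a b m * Π (a + m * b) b n * (a + m * b + n * b)    ≡⟨ *-assoc (Π a b m) _ _ ⟩
  Π a b m * Π (a + m * b) b (suc n)                    ∎
  where open ≡-Reasoning

Π-mono-∣ : ∀ a b {m n} → m ≤ n → Π a b m ∣ Π a b n
Π-mono-∣ a b {m} {n} m≤n = divides (Π (a + m * b) b (n ∸ m)) (begin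
  Π a b n                              ≡⟨ cong (Π a b) (m+[n∸m]≡n m≤n) ⟨
  Π a b (m + (n ∸ m))                  ≡⟨ Π-+ a b m (n ∸ m) ⟩
  Π a b m * Π (a + m * b) b (n ∸ m)    ≡⟨ *-comm (Π a b m) _ ⟩
  Π (a + m * b) b (n ∸ m) * Π a b m    ∎)
  where open ≡-Reasoning

product-applyUpTo≡Π : ∀ a b n → product (applyUpTo (λ j → a + j * b) n) ≡ Π a b n
product-applyUpTo≡Π a b zero    = refl
product-applyUpTo≡Π a b (suc n) = begin
  product (applyUpTo f (suc n))          ≡⟨ cong product (applyUpTo-∷ʳ f n) ⟨
  product (applyUpTo f n ∷ʳ f n)         ≡⟨ product-++ (applyUpTo f n) (f n ∷ []) ⟩
  product (applyUpTo f n) * (f n * 1)    ≡⟨ cong₂ _*_ (product-applyUpTo≡Π a b n) (*-identityʳ (f n)) ⟩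
  Π a b (suc n)                          ∎
  where
  open ≡-Reasoning
  f = λ j → a + j * b

risingProd≡Π : ∀ n k → risingProd n k ≡ Π 1 k n
risingProd≡Π n k = trans (cong product (map-applyUpTo id _ n)) (product-applyUpTo≡Π 1 k n)

n!≡Π : ∀ n → n ! ≡ Π 1 1 n
n!≡Π zero    = refl
n!≡Π (suc n) = trans (cong (suc n *_) (n!≡Π n)) (regroup n (Π 1 1 n))
  where
  regroup : ∀ n x → suc n * x ≡ x * (1 + n * 1)
  regroup = solve-∀

^-monoʳ-∣ : ∀ q {m n} → m ≤ n → q ^ m ∣ q ^ n
^-monoʳ-∣ q {m} {n} m≤n = divides (q ^ (n ∸ m)) (begin
  q ^ n                  ≡⟨ cong (q ^_) (m+[n∸m]≡n m≤n) ⟨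
  q ^ (m + (n ∸ m))      ≡⟨ ^-distribˡ-+-* q m (n ∸ m) ⟩
  q ^ m * q ^ (n ∸ m)    ≡⟨ *-comm (q ^ m) _ ⟩
  q ^ (n ∸ m) * q ^ m    ∎)
  where open ≡-Reasoning

^-monoˡ-∣ : ∀ {m n} e → m ∣ n → m ^ e ∣ n ^ e
^-monoˡ-∣ zero    _   = ∣-refl
^-monoˡ-∣ (suc e) m∣n = *-pres-∣ m∣n (^-monoˡ-∣ e m∣n)

^∣^*⇒∣ : ∀ q .{{_ : NonZero q}} e t {x} → q ^ e ∣ q ^ t * x → q ^ (e ∸ t) ∣ x
^∣^*⇒∣ q e t {x} q^e∣q^t*x with ≤-total t e
... | inj₂ e≤t = subst (λ d → q ^ d ∣ x) (sym (m≤n⇒m∸n≡0 e≤t)) (1∣ x)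
... | inj₁ t≤e = *-cancelˡ-∣ (q ^ t) {{m^n≢0 q t}} (subst (_∣ q ^ t * x) q^e≡q^t*q^[e∸t] q^e∣q^t*x)
  where
  q^e≡q^t*q^[e∸t] : q ^ e ≡ q ^ t * q ^ (e ∸ t)
  q^e≡q^t*q^[e∸t] = trans (cong (q ^_) (sym (m+[n∸m]≡n t≤e))) (^-distribˡ-+-* q t (e ∸ t))

∣⇒^∣^* : ∀ q e t {x} → q ^ (e ∸ t) ∣ x → q ^ e ∣ q ^ t * x
∣⇒^∣^* q e t q^[e∸t]∣x = ∣-trans
  (subst (q ^ e ∣_) (^-distribˡ-+-* q t (e ∸ t)) (^-monoʳ-∣ q (m≤n+m∸n e t)))
  (*-monoʳ-∣ (q ^ t) q^[e∸t]∣x)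

module _ {q : ℕ} (q-prime : Prime q) where

  private instance
    q≢0 : NonZero q
    q≢0 = prime⇒nonZero q-prime

  q>1 : 1 < q
  q>1 = nonTrivial⇒n>1 q {{prime⇒nonTrivial q-prime}}

  ∤1 : ¬ q ∣ 1
  ∤1 = >⇒∤ q>1

  ∣-*-cancelʳ-∤ : ∀ {m n} → ¬ q ∣ n → q ∣ m * n → q ∣ m
  ∣-*-cancelʳ-∤ {m} {n} q∤n q∣m*n with euclidsLemma m n q-prime q∣m*n
  ... | inj₁ q∣m = q∣m
  ... | inj₂ q∣n = contradiction q∣n q∤n

  ∤-* : ∀ {m n} → ¬ q ∣ m → ¬ q ∣ n → ¬ q ∣ m * n
  ∤-* q∤m q∤n = q∤m ∘ ∣-*-cancelʳ-∤ q∤n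

  ∤-^ : ∀ {m} e → ¬ q ∣ m → ¬ q ∣ m ^ e
  ∤-^ zero    _   = ∤1
  ∤-^ (suc e) q∤m = ∤-* q∤m (∤-^ e q∤m)

  ^∣-*-cancelʳ-∤ : ∀ e {m n} → ¬ q ∣ n → q ^ e ∣ m * n → q ^ e ∣ m
  ^∣-*-cancelʳ-∤ zero    {m} _ _ = 1∣ m
  ^∣-*-cancelʳ-∤ (suc e) {m} {n} q∤n q^[1+e]∣m*n
    with ∣-*-cancelʳ-∤ {m = m} q∤n (m*n∣⇒m∣ q (q ^ e) q^[1+e]∣m*n)
  ... | divides m′ refl = subst (q * q ^ e ∣_) (*-comm q m′)
          (*-monoʳ-∣ q (^∣-*-cancelʳ-∤ e q∤n (*-cancelˡ-∣ q q^[1+e]∣q*[m′*n])))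
    where
    regroup : ∀ m′ q n → m′ * q * n ≡ q * (m′ * n)
    regroup = solve-∀
    q^[1+e]∣q*[m′*n] : q * q ^ e ∣ q * (m′ * n)
    q^[1+e]∣q*[m′*n] = subst (q * q ^ e ∣_) (regroup m′ q n) q^[1+e]∣m*n

  ∣⇔∣-unitMultiple : ∀ {m n x y} → ¬ q ∣ x → ¬ q ∣ y → m * x ≡ y * n → q ∣ m ⇔ q ∣ n
  ∣⇔∣-unitMultiple {m} {n} {x} {y} q∤x q∤y m*x≡y*n = mk⇔
    (λ q∣m → ∣-*-cancelʳ-∤ q∤y (subst (q ∣_) (trans m*x≡y*n (*-comm y n)) (∣-trans q∣m (m∣m*n x))))
    (λ q∣n → ∣-*-cancelʳ-∤ q∤x (subst (q ∣_) (sym m*x≡y*n) (∣-trans q∣n (n∣m*n y))))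

  Π-∤ : ∀ {a b} n → (∀ {j} → j < n → ¬ q ∣ a + j * b) → ¬ q ∣ Π a b n
  Π-∤ zero    _       = ∤1
  Π-∤ (suc n) q∤terms = ∤-* (Π-∤ n (q∤terms ∘ m<n⇒m<1+n)) (q∤terms (n<1+n n))

  module _ {b : ℕ} (q∤b : ¬ q ∣ b) where

    AP-gap : ∀ {a i j} → i < j → j < q → q ∣ a + i * b → ¬ q ∣ a + j * b
    AP-gap {a} {i} {j} i<j j<q q∣aᵢ q∣aⱼ =
      >⇒∤ {{>-nonZero (m<n⇒0<n∸m i<j)}} (≤-<-trans (m∸n≤m j i) j<q) (∣-*-cancelʳ-∤ q∤b q∣[j∸i]*b)
      where
      aⱼ≡aᵢ+[j∸i]*b : a + j * b ≡ a + i * b + (j ∸ i) * b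
      aⱼ≡aᵢ+[j∸i]*b = trans (cong (λ x → a + x * b) (sym (m+[n∸m]≡n (<⇒≤ i<j)))) (AP-shift a b i (j ∸ i))
      q∣[j∸i]*b : q ∣ (j ∸ i) * b
      q∣[j∸i]*b = ∣m+n∣m⇒∣n (subst (q ∣_) aⱼ≡aᵢ+[j∸i]*b q∣aⱼ) q∣aᵢ

    AP-∤ : ∀ {a u j} → u < q → j < q → j ≢ u → q ∣ a + u * b → ¬ q ∣ a + j * b
    AP-∤ {u = u} {j} u<q j<q j≢u q∣aᵤ with <-cmp j u
    ... | tri< j<u _ _ = λ q∣aⱼ → AP-gap j<u u<q q∣aⱼ q∣aᵤ
    ... | tri≈ _ j≡u _ = contradiction j≡u j≢u
    ... | tri> _ _ u<j = AP-gap u<j j<q q∣aᵤ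

    coprime : Coprime b q
    coprime (d∣b , d∣q) with prime⇒irreducible q-prime d∣q
    ... | inj₁ d≡1 = d≡1
    ... | inj₂ d≡q = contradiction (subst (_∣ b) d≡q d∣b) q∤b

    AP-∣ : ∀ a → ∃[ u ] q ∣ a + u * b
    AP-∣ a with coprime-Bézout coprime
    ... | Bézout.-+ x y 1+x*b≡y*q = a * x , divides (a * y) (begin
      a + a * x * b    ≡⟨ regroup a x b ⟩
      a * (1 + x * b)  ≡⟨ cong (a *_) 1+x*b≡y*q ⟩
      a * (y * q)      ≡⟨ *-assoc a y q ⟨
      a * y * q        ∎)
      where
      open ≡-Reasoning
      regroup : ∀ a x b → a + a * x * b ≡ a * (1 + x * b)
      regroup = solve-∀
    -- here x is an inverse of b modulo q, and q - 1 acts as -1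
    ... | Bézout.+- x y 1+y*q≡x*b = a * pred q * x , divides (a + a * pred q * y) (begin
      a + a * pred q * x * b                    ≡⟨ cong (a +_) (*-assoc (a * pred q) x b) ⟩
      a + a * pred q * (x * b)                  ≡⟨ cong (λ z → a + a * pred q * z) 1+y*q≡x*b ⟨
      a + a * pred q * (1 + y * q)              ≡⟨ cong (λ z → a + a * pred q * (1 + y * z)) (suc-pred q) ⟨
      a + a * pred q * (1 + y * suc (pred q))   ≡⟨ regroup a (pred q) y ⟩
      (a + a * pred q * y) * suc (pred q)       ≡⟨ cong ((a + a * pred q * y) *_) (suc-pred q) ⟩
      (a + a * pred q * y) * q                  ∎)
      where
      open ≡-Reasoning
      regroup : ∀ a p y → a + a * p * (1 + y * suc p) ≡ (a + a * p * y) * suc p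
      regroup = solve-∀

    AP-multiple : ∀ a → ∃[ u ] ∃[ w ] u < q × a + u * b ≡ q * w
    AP-multiple a with AP-∣ a
    ... | u , q∣aᵤ with ∣m+n∣m⇒∣n (subst (q ∣_) split q∣aᵤ) (∣-trans (n∣m*n (u / q)) (m∣m*n b))
      where
      split : a + u * b ≡ u / q * q * b + (a + u % q * b)
      split = trans (cong (λ z → a + z * b) (m≡m%n+[m/n]*n u q))
                    (trans (AP-shift a b (u % q) (u / q * q)) (+-comm (a + u % q * b) _))
    ... | divides w aᵣ≡w*q = u % q , w , m%n<n u q , trans aᵣ≡w*q (*-comm w q)

    Π-∤-below : ∀ {a u w r} → u < q → a + u * b ≡ q * w → r ≤ u → ¬ q ∣ Π a b r
    Π-∤-below {w = w} {r} u<q aᵤ≡q*w r≤u = Π-∤ r (λ j<r →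
      AP-∤ u<q (<-≤-trans j<r (≤-trans r≤u (<⇒≤ u<q))) (<⇒≢ (<-≤-trans j<r r≤u))
           (divides w (trans aᵤ≡q*w (*-comm q w))))

    Π-above : ∀ {a u w r} → u < q → a + u * b ≡ q * w → u < r → r ≤ q →
              ∃[ U ] ¬ q ∣ U × Π a b r ≡ q * w * U
    Π-above {a} {u} {w} {r} u<q aᵤ≡q*w u<r r≤q =
      Π a b u * rest , ∤-* (Π-∤-below u<q aᵤ≡q*w ≤-refl) q∤rest , (begin
        Π a b r                          ≡⟨ cong (Π a b) (m+[n∸m]≡n u<r) ⟨
        Π a b (suc u + d)                ≡⟨ Π-+ a b (suc u) d ⟩
        Π a b u * (a + u * b) * rest     ≡⟨ cong (λ x → Π a b u * x * rest) aᵤ≡q*w ⟩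
        Π a b u * (q * w) * rest         ≡⟨ regroup (Π a b u) (q * w) rest ⟩
        q * w * (Π a b u * rest)         ∎)
      where
      open ≡-Reasoning
      d = r ∸ suc u
      rest = Π (a + suc u * b) b d
      regroup : ∀ x y z → x * y * z ≡ y * (x * z)
      regroup = solve-∀
      q∤rest : ¬ q ∣ rest
      q∤rest = Π-∤ d (λ {j} j<d → subst (λ x → ¬ q ∣ x) (AP-shift a b (suc u) j)
        (AP-∤ u<q (<-≤-trans (+-monoʳ-< (suc u) j<d) (≤-trans (≤-reflexive (m+[n∸m]≡n u<r)) r≤q))
              (>⇒≢ (m≤m+n (suc u) j)) (divides w (trans aᵤ≡q*w (*-comm q w)))))

    module _ {a u w : ℕ} (u<q : u < q) (aᵤ≡q*w : a + u * b ≡ q * w) where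

      private
        shifted : ∀ t → a + t * q * b + u * b ≡ q * (w + t * b)
        shifted t = begin
          a + t * q * b + u * b      ≡⟨ regroup a t q b u ⟩
          (a + u * b) + q * (t * b)  ≡⟨ cong (_+ q * (t * b)) aᵤ≡q*w ⟩
          q * w + q * (t * b)        ≡⟨ *-distribˡ-+ q w (t * b) ⟨
          q * (w + t * b)            ∎
          where
          open ≡-Reasoning
          regroup : ∀ a t q b u → a + t * q * b + u * b ≡ (a + u * b) + q * (t * b)
          regroup = solve-∀

        absorb : ∀ t r {U V} → Π a b (t * q) ≡ q ^ t * Π w b t * U →
                 Π (a + t * q * b) b r ≡ q * (w + t * b) * V →
                 Π a b (t * q + r) ≡ q ^ suc t * Π w b (suc t) * (U * V)
        absorb t r {U} {V} eqᵤ eqᵥ = begin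
          Π a b (t * q + r)                                ≡⟨ Π-+ a b (t * q) r ⟩
          Π a b (t * q) * Π (a + t * q * b) b r            ≡⟨ cong₂ _*_ eqᵤ eqᵥ ⟩
          q ^ t * Π w b t * U * (q * (w + t * b) * V)      ≡⟨ regroup (q ^ t) (Π w b t) U q (w + t * b) V ⟩
          q * q ^ t * (Π w b t * (w + t * b)) * (U * V)    ∎
          where
          open ≡-Reasoning
          regroup : ∀ x y U q z V → x * y * U * (q * z * V) ≡ q * x * (y * z) * (U * V)
          regroup = solve-∀

        n≡t*q+r : ∀ n → n ≡ n / q * q + n % q
        n≡t*q+r n = trans (m≡m%n+[m/n]*n n q) (+-comm (n % q) _)

      Π-blocks : ∀ t → ∃[ U ] ¬ q ∣ U × Π a b (t * q) ≡ q ^ t * Π w b t * U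
      Π-blocks zero    = 1 , ∤1 , refl
      Π-blocks (suc t) =
        let U , q∤U , eqᵤ = Π-blocks t
            V , q∤V , eqᵥ = Π-above u<q (shifted t) u<q ≤-refl
        in U * V , ∤-* q∤U q∤V , trans (cong (Π a b) (+-comm q (t * q))) (absorb t q eqᵤ eqᵥ)

      Π-digit-low : ∀ n → n % q ≤ u → ∃[ U ] ¬ q ∣ U × Π a b n ≡ q ^ (n / q) * Π w b (n / q) * U
      Π-digit-low n r≤u =
        let U , q∤U , eqᵤ = Π-blocks t
        in U * last , ∤-* q∤U (Π-∤-below u<q (shifted t) r≤u) , (begin
          Π a b n                                ≡⟨ cong (Π a b) (n≡t*q+r n) ⟩
          Π a b (t * q + n % q)                  ≡⟨ Π-+ a b (t * q) (n % q) ⟩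
          Π a b (t * q) * last                   ≡⟨ cong (_* last) eqᵤ ⟩
          q ^ t * Π w b t * U * last             ≡⟨ *-assoc (q ^ t * Π w b t) U last ⟩
          q ^ t * Π w b t * (U * last)           ∎)
        where
        open ≡-Reasoning
        t = n / q
        last = Π (a + t * q * b) b (n % q)

      Π-digit-high : ∀ n → u < n % q →
                     ∃[ U ] ¬ q ∣ U × Π a b n ≡ q ^ suc (n / q) * Π w b (suc (n / q)) * U
      Π-digit-high n u<r =
        let U , q∤U , eqᵤ = Π-blocks t
            V , q∤V , eqᵥ = Π-above u<q (shifted t) u<r (<⇒≤ (m%n<n n q))
        in U * V , ∤-* q∤U q∤V , trans (cong (Π a b) (n≡t*q+r n)) (absorb t (n % q) eqᵤ eqᵥ)
        where t = n / q

    Π-blocks-∣ : ∀ a t → ∃[ w ] q ^ t * Π w b t ∣ Π a b (t * q)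
    Π-blocks-∣ a t =
      let u , w , u<q , aᵤ≡q*w = AP-multiple a
          U , _ , eq = Π-blocks u<q aᵤ≡q*w t
      in w , subst (q ^ t * Π w b t ∣_) (sym eq) (m∣m*n U)

  private
    1+[q-1]≡q : 1 + pred q * 1 ≡ q * 1
    1+[q-1]≡q = trans (cong suc (*-identityʳ (pred q))) (trans (suc-pred q) (sym (*-identityʳ q)))

  !-digit : ∀ n → ∃[ B ] ¬ q ∣ B × n ! ≡ q ^ (n / q) * (n / q) ! * B
  !-digit n =
    let B , q∤B , eq = Π-digit-low ∤1 (≤-reflexive (suc-pred q)) 1+[q-1]≡q n (<⇒≤pred (m%n<n n q))
    in B , q∤B , (begin
      n !                              ≡⟨ n!≡Π n ⟩
      Π 1 1 n                          ≡⟨ eq ⟩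
      q ^ (n / q) * Π 1 1 (n / q) * B  ≡⟨ cong (λ x → q ^ (n / q) * x * B) (n!≡Π (n / q)) ⟨
      q ^ (n / q) * (n / q) ! * B      ∎)
    where open ≡-Reasoning

  ^∣!⇒^∣[/]! : ∀ {e} n → q ^ e ∣ n ! → q ^ (e ∸ n / q) ∣ (n / q) !
  ^∣!⇒^∣[/]! {e} n q^e∣n! =
    let B , q∤B , eq = !-digit n
    in ^∣^*⇒∣ q e (n / q) (^∣-*-cancelʳ-∤ e q∤B (subst (q ^ e ∣_) eq q^e∣n!))

  ^∣!⇒≤ : ∀ n {e} → q ^ e ∣ n ! → e ≤ n
  ^∣!⇒≤ = <-rec _ step
    where
    step : ∀ n → (∀ {m} → m < n → ∀ {e} → q ^ e ∣ m ! → e ≤ m) → ∀ {e} → q ^ e ∣ n ! → e ≤ n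
    step zero      _  {zero}  _      = z≤n
    step zero      _  {suc e} q^e∣1  = contradiction (m*n∣⇒m∣ q (q ^ e) q^e∣1) ∤1
    step n@(suc _) ih {e}     q^e∣n! = begin
      e              ≤⟨ m≤n+m∸n e t ⟩
      t + (e ∸ t)    ≤⟨ +-monoʳ-≤ t (ih (m/n<m n q q>1) {e ∸ t} (^∣!⇒^∣[/]! {e} n q^e∣n!)) ⟩
      t + t          ≡⟨ double t ⟩
      t * 2          ≤⟨ *-monoʳ-≤ t q>1 ⟩
      t * q          ≤⟨ m/n*n≤m n q ⟩
      n              ∎
      where
      open ≤-Reasoning
      t = n / q
      double : ∀ t → t + t ≡ t * 2
      double = solve-∀

  ^∣!⇒^∣Π : ∀ {b} → ¬ q ∣ b → ∀ n {a e} → q ^ e ∣ n ! → q ^ e ∣ Π a b n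
  ^∣!⇒^∣Π {b} q∤b = <-rec _ step
    where
    step : ∀ n → (∀ {m} → m < n → ∀ {a e} → q ^ e ∣ m ! → q ^ e ∣ Π a b m) →
           ∀ {a e} → q ^ e ∣ n ! → q ^ e ∣ Π a b n
    step zero      _  q^e∣1 = q^e∣1
    step n@(suc _) ih {a} {e} q^e∣n! =
      let w , blocks∣ = Π-blocks-∣ q∤b a t in begin
      q ^ e              ∣⟨ ∣⇒^∣^* q e t (ih (m/n<m n q q>1) {w} {e ∸ t} (^∣!⇒^∣[/]! {e} n q^e∣n!)) ⟩
      q ^ t * Π w b t    ∣⟨ blocks∣ ⟩
      Π a b (t * q)      ∣⟨ Π-mono-∣ a b (m/n*n≤m n q) ⟩
      Π a b n            ∎
      where
      open ∣-Reasoning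
      t = n / q

prime∤prime : ∀ {p q} → Prime p → Prime q → p ≢ q → ¬ p ∣ q
prime∤prime p-prime q-prime p≢q p∣q with prime⇒irreducible q-prime p∣q
... | inj₁ p≡1 = ¬prime[1] (subst Prime p≡1 p-prime)
... | inj₂ p≡q = p≢q p≡q

product-∣ : ∀ {ps y} → All Prime ps → (∀ q e → Prime q → q ^ e ∣ product ps → q ^ e ∣ y) → product ps ∣ y
product-∣ {[]}     {y} []                   _        = 1∣ y
product-∣ {p ∷ ps} {y} (p-prime ∷ ps-prime) powers∣y
  with subst (_∣ y) (*-identityʳ p) (powers∣y p 1 p-prime (*-monoʳ-∣ p (1∣ product ps)))
... | divides y′ refl =
  subst (_∣ y′ * p) (*-comm (product ps) p) (*-monoˡ-∣ p (product-∣ ps-prime powers∣y′))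
  where
  instance p≢0 = prime⇒nonZero p-prime
  powers∣y′ : ∀ q e → Prime q → q ^ e ∣ product ps → q ^ e ∣ y′
  powers∣y′ q e q-prime q^e∣ps with q ≟ p
  ... | yes refl = *-cancelʳ-∣ p (subst (_∣ y′ * p) (*-comm p (p ^ e))
                     (powers∣y p (suc e) p-prime (*-monoʳ-∣ p q^e∣ps)))
  ... | no q≢p   = ^∣-*-cancelʳ-∤ q-prime e (prime∤prime q-prime p-prime q≢p)
                     (powers∣y q e q-prime (∣-trans q^e∣ps (n∣m*n p)))

∣-byPrimePowers : ∀ d .{{_ : NonZero d}} {y} → (∀ q e → Prime q → q ^ e ∣ d → q ^ e ∣ y) → d ∣ y
∣-byPrimePowers d powers∣y = subst (_∣ _) (sym isFactorisation)
  (product-∣ factorsPrime (λ q e q-prime → powers∣y q e q-prime ∘ subst (q ^ e ∣_) (sym isFactorisation)))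
  where open PrimeFactorisation (factorise d)

n!∣k^n*Π : ∀ n k → n ! ∣ k ^ n * Π 1 k n
n!∣k^n*Π n k = ∣-byPrimePowers (n !) {{n !≢0}} prime-power∣
  where
  prime-power∣ : ∀ q e → Prime q → q ^ e ∣ n ! → q ^ e ∣ k ^ n * Π 1 k n
  prime-power∣ q e q-prime q^e∣n! with q ∣? k
  ... | yes q∣k = ∣-trans (^-monoʳ-∣ q (^∣!⇒≤ q-prime n {e} q^e∣n!)) (∣-trans (^-monoˡ-∣ n q∣k) (m∣m*n _))
  ... | no  q∤k = ∣-trans (^∣!⇒^∣Π q-prime q∤k n {1} {e} q^e∣n!) (n∣m*n (k ^ n))

c*n!≡k^n*Π : ∀ n k → c n k * n ! ≡ k ^ n * Π 1 k n
c*n!≡k^n*Π n k = trans (cong (λ x → k ^ n * x / n ! * n !) (risingProd≡Π n k)) (m/n*n≡m (n!∣k^n*Π n k))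
  where instance _ = n !≢0

c-rescale : ∀ n s k {B E F G U} .{{_ : NonZero F}} → n ! ≡ F * B → Π 1 k n ≡ E * Π 1 k s * U →
            E * s ! ≡ G * F → c n k * (B * k ^ s) ≡ k ^ n * U * G * c s k
c-rescale n s k {B} {E} {F} {G} {U} n!≡F*B Π≡E*Π*U E*s!≡G*F = *-cancelʳ-≡ _ _ F (begin
  c n k * (B * k ^ s) * F              ≡⟨ regroup₁ (c n k) B (k ^ s) F ⟩
  c n k * (F * B) * k ^ s              ≡⟨ cong (λ x → c n k * x * k ^ s) n!≡F*B ⟨
  c n k * n ! * k ^ s                  ≡⟨ cong (_* k ^ s) (c*n!≡k^n*Π n k) ⟩
  k ^ n * Π 1 k n * k ^ s              ≡⟨ cong (λ x → k ^ n * x * k ^ s) Π≡E*Π*U ⟩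
  k ^ n * (E * Π 1 k s * U) * k ^ s    ≡⟨ regroup₂ (k ^ n) E (Π 1 k s) U (k ^ s) ⟩
  k ^ n * U * (k ^ s * Π 1 k s) * E    ≡⟨ cong (λ x → k ^ n * U * x * E) (c*n!≡k^n*Π s k) ⟨
  k ^ n * U * (c s k * s !) * E        ≡⟨ regroup₃ (k ^ n * U) (c s k) (s !) E ⟩
  k ^ n * U * c s k * (E * s !)        ≡⟨ cong (k ^ n * U * c s k *_) E*s!≡G*F ⟩
  k ^ n * U * c s k * (G * F)          ≡⟨ regroup₄ (k ^ n * U) (c s k) G F ⟩
  k ^ n * U * G * c s k * F            ∎)
  where
  open ≡-Reasoning
  regroup₁ : ∀ c B K F → c * (B * K) * F ≡ c * (F * B) * K
  regroup₁ = solve-∀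
  regroup₂ : ∀ K E Π U K′ → K * (E * Π * U) * K′ ≡ K * U * (K′ * Π) * E
  regroup₂ = solve-∀
  regroup₃ : ∀ Y c S E → Y * (c * S) * E ≡ Y * c * (E * S)
  regroup₃ = solve-∀
  regroup₄ : ∀ Y c G F → Y * c * (G * F) ≡ Y * G * c * F
  regroup₄ = solve-∀

digit-zero : ∀ p .{{_ : NonZero p}} n → digit p n 0 ≡ n % p
digit-zero p n = cong (_% p) (n/1≡n n)

digit-suc : ∀ p .{{_ : NonZero p}} n i → digit p n (suc i) ≡ digit p (n / p) i
digit-suc p n i = cong (_% p) (sym (m/n/o≡m/[n*o] n p (p ^ i) {{_}} {{m^n≢0 p i}} {{m^n≢0 p (suc i)}}))

digit-of-0 : ∀ p .{{_ : NonZero p}} i → digit p 0 i ≡ 0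
digit-of-0 p i = trans (cong (_% p) (0/n≡0 (p ^ i) {{m^n≢0 p i}})) (m<n⇒m%n≡m (>-nonZero⁻¹ p))

∀-digits⇔ : ∀ p .{{_ : NonZero p}} (Q : ℕ → Set) n →
            (∀ i → Q (digit p n i)) ⇔ (Q (n % p) × ∀ i → Q (digit p (n / p) i))
∀-digits⇔ p Q n = mk⇔
  (λ Qᵢ → subst Q (digit-zero p n) (Qᵢ 0) , λ i → subst Q (digit-suc p n i) (Qᵢ (suc i)))
  (λ { (Q₀ , Qₛ) zero    → subst Q (sym (digit-zero p n)) Q₀
     ; (Q₀ , Qₛ) (suc i) → subst Q (sym (digit-suc p n i)) (Qₛ i) })

module _ {k u : ℕ} (k≥1 : 1 ≤ k) (P-prime : Prime (k * u + 1)) where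

  private
    P = k * u + 1

    instance
      P≢0 : NonZero P
      P≢0 = prime⇒nonZero P-prime

    u≢0 : NonZero u
    u≢0 = ≢-nonZero λ u≡0 → ¬prime[1]
      (subst Prime (trans (+-comm (k * u) 1) (cong suc (trans (cong (k *_) u≡0) (*-zeroʳ k)))) P-prime)

    u<P : u < P
    u<P = subst (u <_) (+-comm 1 (k * u)) (s≤s (m≤n*m u k {{>-nonZero k≥1}}))

    P∤k : ¬ P ∣ k
    P∤k = >⇒∤ {{>-nonZero k≥1}} (subst (k <_) (+-comm 1 (k * u)) (s≤s (m≤m*n k u {{u≢0}})))

    1+u*k≡P*1 : 1 + u * k ≡ P * 1
    1+u*k≡P*1 = regroup k u
      where
      regroup : ∀ k u → 1 + u * k ≡ (k * u + 1) * 1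
      regroup = solve-∀

    P^t*t!≢0 : ∀ t → NonZero (P ^ t * t !)
    P^t*t!≢0 t = m*n≢0 (P ^ t) (t !) {{m^n≢0 P t}} {{t !≢0}}

  k*r<P⇔r≤u : ∀ {r} → k * r < P ⇔ r ≤ u
  k*r<P⇔r≤u {r} = mk⇔
    (λ k*r<P → *-cancelˡ-≤ k {{>-nonZero k≥1}} (≤-pred (subst (k * r <_) (+-comm (k * u) 1) k*r<P)))
    (λ r≤u → subst (k * r <_) (+-comm 1 (k * u)) (s≤s (*-monoʳ-≤ k r≤u)))

  P∣c⇔P∣c[n/P] : ∀ n → n % P ≤ u → P ∣ c n k ⇔ P ∣ c (n / P) k
  P∣c⇔P∣c[n/P] n r≤u =
    let B , P∤B , n!≡ = !-digit P-prime n
        U , P∤U , Π≡  = Π-digit-low P-prime P∤k u<P 1+u*k≡P*1 n r≤u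
    in ∣⇔∣-unitMultiple P-prime (∤-* P-prime P∤B (∤-^ P-prime t P∤k))
         (∤-* P-prime (∤-* P-prime (∤-^ P-prime n P∤k) P∤U) (∤1 P-prime))
         (c-rescale n t k {E = P ^ t} {{P^t*t!≢0 t}} n!≡ Π≡ (sym (*-identityˡ _)))
    where t = n / P

  P∣c-highDigit : ∀ n → u < n % P → P ∣ c n k
  P∣c-highDigit n u<r =
    let B , P∤B , n!≡ = !-digit P-prime n
        U , P∤U , Π≡  = Π-digit-high P-prime P∤k u<P 1+u*k≡P*1 n u<r
        P∣rhs : P ∣ k ^ n * U * (P * suc t) * c (suc t) k
        P∣rhs = ∣-trans (∣-trans (m∣m*n (suc t)) (n∣m*n (k ^ n * U))) (m∣m*n (c (suc t) k))
        c≡ : c n k * (B * k ^ suc t) ≡ k ^ n * U * (P * suc t) * c (suc t) k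
        c≡ = c-rescale n (suc t) k {E = P ^ suc t} {{P^t*t!≢0 t}} n!≡ Π≡ (regroup P (P ^ t) (suc t) (t !))
    in ∣-*-cancelʳ-∤ P-prime (∤-* P-prime P∤B (∤-^ P-prime (suc t) P∤k)) (subst (P ∣_) (sym c≡) P∣rhs)
    where
    t = n / P
    regroup : ∀ P E s F → P * E * (s * F) ≡ P * s * (E * F)
    regroup = solve-∀

  P∤c⇔lowDigit×P∤c[n/P] : ∀ n → (¬ P ∣ c n k) ⇔ (k * (n % P) < P × ¬ P ∣ c (n / P) k)
  P∤c⇔lowDigit×P∤c[n/P] n = [ low , high ]′ (≤-<-connex (n % P) u)
    where
    low : n % P ≤ u → (¬ P ∣ c n k) ⇔ (k * (n % P) < P × ¬ P ∣ c (n / P) k)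
    low r≤u = mk⇔
      (λ P∤cₙ → Equivalence.from (k*r<P⇔r≤u {n % P}) r≤u , λ P∣cₜ → P∤cₙ (Equivalence.from P∣cₙ⇔P∣cₜ P∣cₜ))
      (λ (_ , P∤cₜ) P∣cₙ → P∤cₜ (Equivalence.to P∣cₙ⇔P∣cₜ P∣cₙ))
      where
      P∣cₙ⇔P∣cₜ : P ∣ c n k ⇔ P ∣ c (n / P) k
      P∣cₙ⇔P∣cₜ = P∣c⇔P∣c[n/P] n r≤u
    high : u < n % P → (¬ P ∣ c n k) ⇔ (k * (n % P) < P × ¬ P ∣ c (n / P) k)
    high u<r = mk⇔ (λ P∤cₙ → contradiction (P∣c-highDigit n u<r) P∤cₙ)
                   (λ (k*r<P , _) → contradiction (Equivalence.to k*r<P⇔r≤u k*r<P) (<⇒≱ u<r))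

  P∤c⇔lowDigits : ∀ n → (¬ P ∣ c n k) ⇔ (∀ i → k * digit P n i < P)
  P∤c⇔lowDigits = <-rec _ step
    where
    step : ∀ n → (∀ {m} → m < n → (¬ P ∣ c m k) ⇔ (∀ i → k * digit P m i < P)) →
           (¬ P ∣ c n k) ⇔ (∀ i → k * digit P n i < P)
    step zero      _  = mk⇔ (λ _ i → subst (λ d → k * d < P) (sym (digit-of-0 P i)) k*0<P)
                             (λ _ → ∤1 P-prime)
      where k*0<P = subst (_< P) (sym (*-zeroʳ k)) (>-nonZero⁻¹ P)
    step n@(suc _) ih = ⇔.trans (P∤c⇔lowDigit×P∤c[n/P] n)
      (⇔.trans (⇔.refl ×-⇔ ih (m/n<m n P (q>1 P-prime))) (⇔.sym (∀-digits⇔ P (λ d → k * d < P) n)))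

theorem3p6 : (k : ℕ) → 1 ≤ k → (p u : ℕ) → .{{_ : NonZero p}} → Prime p → p ≡ k * u + 1 → (n : ℕ)
             → (¬ (p ∣ c n k)) ⇔ ((i : ℕ) → k * digit p n i < p)
theorem3p6 k k≥1 p u p-prime refl = P∤c⇔lowDigits k≥1 p-prime
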